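{- Let $n,m,b\in\mathbb{N}_+$ and let $A\in\{0,1\}^{n\times m}$ be an authorship matrix. Consider the procedure \textsc{BackwardReject}$(A,n,m,b)$: initialize $P_i\gets\{j\in[m]:A_{i,j}=1\}$ for every $i\in[n]$; for $j=m,m-1,\dots,1$ in order, let $S=\{i\in[n]:A_{i,j}=1\}$, and if there exists $i\in S$ with $|P_i|>b$, then set $P_i\gets P_i\setminus\{j\}$ for every $i\in S$; finally let $P=\bigcup_{i=1}^n P_i$ and output $x\in\{0,1\}^m$ with $x_j=1$ if $j\in P$ and $x_j=0$ otherwise. Then \textsc{BackwardReject} runs in $O(nk_1+mk_2)$ time and outputs a feasible solution of the submission limit problem, i.e. a vector $x\in\{0,1\}^m$ with $\sum_{j=1}^m A_{i,j}x_j\le b$ for all $i\in[n]$.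
   Context: $[n]=\{1,\dots,n\}$. $A_{i,j}=1$ means author $i$ is an author of paper $j$, and $A_{i,j}=0$ otherwise; $b$ is the maximum number of papers allowed per author. Define $k_1:=\max_{i\in[n]}|\{j\in[m]:A_{i,j}=1\}|$ (maximum number of papers of any single author) and $k_2:=\max_{j\in[m]}|\{i\in[n]:A_{i,j}=1\}|$ (maximum number of authors of any single paper). Running times are measured under the convention that the set of papers of a given author can be listed in $O(k_1)$ time and the set of authors of a given paper in $O(k_2)$ time, and that checking the condition on $S$ takes $O(k_2)$ time. -}

module Defs where

open import Data.Nat using (ℕ; zero; suc; _+_; _*_; _⊔_; _<ᵇ_)
open import Data.Bool using (Bool; true; false; _∧_; _∨_; not; if_then_else_)
open import Data.Fin using (Fin; zero; suc; _≟_)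
open import Data.List using (List; reverse; foldl; allFin)
open import Data.Product using (_×_; _,_; proj₁; proj₂)
open import Relation.Nullary.Decidable using (⌊_⌋)

-- An authorship matrix: A i j = true iff author i is an author of paper j.
-- Authors are indexed by Fin n (i.e. [n]), papers by Fin m (i.e. [m]).
Matrix : ℕ → ℕ → Set
Matrix n m = Fin n → Fin m → Bool

Subset : ℕ → Set
Subset m = Fin m → Bool

card : ∀ {m} → Subset m → ℕ
card {zero}  f = 0
card {suc m} f = (if f zero then 1 else 0) + card (λ j → f (suc j))

sumF : ∀ {n} → (Fin n → ℕ) → ℕ
sumF {zero}  g = 0
sumF {suc n} g = g zero + sumF (λ i → g (suc i))

maxF : ∀ {n} → (Fin n → ℕ) → ℕ
maxF {zero}  g = 0
maxF {suc n} g = g zero ⊔ maxF (λ i → g (suc i))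

anyF : ∀ {n} → (Fin n → Bool) → Bool
anyF {zero}  p = false
anyF {suc n} p = p zero ∨ anyF (λ i → p (suc i))

module _ {n m : ℕ} (A : Matrix n m) where

  papersOf : Fin n → Subset m
  papersOf i = A i

  authorsOf : Fin m → Subset n
  authorsOf j i = A i j

  k₁ : ℕ
  k₁ = maxF (λ i → card (papersOf i))

  k₂ : ℕ
  k₂ = maxF (λ j → card (authorsOf j))

  State : Set
  State = Fin n → Subset m

  rejectCond : ℕ → State → Fin m → Bool
  rejectCond b P j = anyF (λ i → A i j ∧ (b <ᵇ card (P i)))

  removePaper : State → Fin m → State
  removePaper P j i j' = P i j' ∧ not (A i j ∧ ⌊ j' ≟ j ⌋)

  -- One iteration of the loop for paper j, together with its cost under the
  -- paper's convention: listing S costs |S| (≤ k₂), checking the condition on S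
  -- costs |S| (≤ k₂), and the removal (if performed) touches each i ∈ S once.
  step : ℕ → State × ℕ → Fin m → State × ℕ
  step b (P , c) j with rejectCond b P j
  ... | true  = removePaper P j , c + card (authorsOf j) + card (authorsOf j) + card (authorsOf j)
  ... | false = P , c + card (authorsOf j) + card (authorsOf j)

  -- Initialisation: P_i ← {j : A_{i,j} = 1}; listing the papers of author i costs |papers of i|.
  initState : State
  initState i = papersOf i

  initCost : ℕ
  initCost = sumF (λ i → card (papersOf i))

  -- Loop for j = m, m-1, …, 1 (i.e. Fin indices m-1 down to 0).
  loop : ℕ → State × ℕ
  loop b = foldl (step b) (initState , initCost) (reverse (allFin m))

  -- Output: P = ⋃_i P_i, x_j = 1 iff j ∈ P.  Computing the union lists
  -- each P_i, costing Σ_i |P_i| ≤ Σ_i |papers of i|; we charge the latter.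
  backwardReject : ℕ → Subset m
  backwardReject b j = anyF (λ i → proj₁ (loop b) i j)

  backwardRejectCost : ℕ → ℕ
  backwardRejectCost b = proj₂ (loop b) + sumF (λ i → card (papersOf i))

  -- Feasibility for the submission limit problem: Σ_j A_{i,j} x_j ≤ b for all i.
  -- (Σ_j A_{i,j} x_j for 0/1 values is the number of j with A_{i,j} = x_j = 1.)
  Feasible : ℕ → Subset m → Set
  Feasible b x = ∀ (i : Fin n) → card (λ j → A i j ∧ x j) Data.Nat.≤ b

{-# OPTIONS --safe #-}
module Submission where

-- Every iteration of the loop costs at most 3 k₂, and initialisation and
-- output each cost Σᵢ |papers of i| ≤ n k₁.  For feasibility, every Pᵢ is
-- at all times the set of papers of i that have survived so far (a set R of
-- survivors shared by all authors), and the Pᵢ only shrink.  When paper j is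
-- examined and kept, each author i of j has |Pᵢ| ≤ b, and this persists.
-- Since every paper gets examined, every author with a surviving paper ends
-- with |Pᵢ| ≤ b, and the papers of i selected in x are exactly those in Pᵢ.

open import Defs
open import Data.Nat using (ℕ; _+_; _*_; _≤_; NonZero)
open import Data.Product using (Σ; _×_)

open import Data.Nat using (zero; suc; _<_; _<ᵇ_; z≤n; s≤s)
open import Data.Nat.Properties
  using (≤-trans; ≤-reflexive; ≮⇒≥; ≰⇒>; _≤?_; m≤m+n; m≤m⊔n; m≤n⊔m; n≤1+n;
         +-assoc; +-mono-≤; +-monoˡ-≤; +-monoʳ-≤; *-monoʳ-≤; <ᵇ-reflects-<; module ≤-Reasoning)
open import Data.Nat.Tactic.RingSolver using (solve-∀)
open import Data.Bool using (Bool; true; false; _∧_; not)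
open import Data.Bool.Properties using (∧-assoc; ∧-zeroʳ; ∧-identityʳ; ∧-conicalˡ; ∧-conicalʳ)
open import Data.Fin using (Fin; _≟_) renaming (zero to fzero; suc to fsuc)
open import Data.List using (List; []; _∷_; foldl; reverse; allFin; length)
open import Data.List.Properties using (length-reverse; length-tabulate)
open import Data.List.Membership.Propositional using (_∈_)
open import Data.List.Membership.Propositional.Properties using (∈-allFin)
open import Data.List.Relation.Unary.Any using (here; there)
open import Data.List.Relation.Unary.Any.Properties using (reverse⁺)
open import Data.Product using (_,_; proj₁; proj₂; ∃)
open import Data.Sum using (_⊎_; inj₁; inj₂)
open import Data.Empty using (⊥)
open import Function using (id)
open import Relation.Nullary.Decidable using (⌊_⌋; yes; no)
open import Relation.Nullary.Reflects using (ofⁿ)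
open import Relation.Binary.PropositionalEquality using (_≡_; refl; sym; trans; cong; module ≡-Reasoning)

card-mono : ∀ {m} {f g : Subset m} → (∀ j → f j ≡ true → g j ≡ true) → card f ≤ card g
card-mono {zero}          f⊆g = z≤n
card-mono {suc m} {f} {g} f⊆g with f fzero in f0 | g fzero in g0
... | true  | true  = s≤s (card-mono (λ j → f⊆g (fsuc j)))
... | true  | false with () ← trans (sym g0) (f⊆g fzero f0)
... | false | true  = ≤-trans (card-mono (λ j → f⊆g (fsuc j))) (n≤1+n _)
... | false | false = card-mono (λ j → f⊆g (fsuc j))

card>0⇒nonempty : ∀ {m} (f : Subset m) → 0 < card f → ∃ λ j → f j ≡ true
card>0⇒nonempty {suc m} f 0<card with f fzero in f0
... | true  = fzero , f0
... | false with j , fj ← card>0⇒nonempty (λ j → f (fsuc j)) 0<card = fsuc j , fj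

card≤-byMember : ∀ {m} {b} (f : Subset m) → (∀ j → f j ≡ true → card f ≤ b) → card f ≤ b
card≤-byMember {b = b} f bound with card f ≤? b
... | yes card≤b = card≤b
... | no  card≰b with j , fj ← card>0⇒nonempty f (≤-trans (s≤s z≤n) (≰⇒> card≰b)) = bound j fj

anyF-true⇒∃ : ∀ {n} (p : Fin n → Bool) → anyF p ≡ true → ∃ λ i → p i ≡ true
anyF-true⇒∃ {suc n} p any with p fzero in p0
... | true  = fzero , p0
... | false with i , pi ← anyF-true⇒∃ (λ i → p (fsuc i)) any = fsuc i , pi

anyF-false⇒∀ : ∀ {n} (p : Fin n → Bool) → anyF p ≡ false → ∀ i → p i ≡ false
anyF-false⇒∀ {suc n} p none i with p fzero in p0
anyF-false⇒∀ {suc n} p none fzero    | false = p0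
anyF-false⇒∀ {suc n} p none (fsuc i) | false = anyF-false⇒∀ (λ i → p (fsuc i)) none i

maxF-upperBound : ∀ {n} (g : Fin n → ℕ) i → g i ≤ maxF g
maxF-upperBound g fzero    = m≤m⊔n _ _
maxF-upperBound g (fsuc i) = ≤-trans (maxF-upperBound (λ i → g (fsuc i)) i) (m≤n⊔m _ _)

sumF≤n*maxF : ∀ {n} (g : Fin n → ℕ) → sumF g ≤ n * maxF g
sumF≤n*maxF {zero}  g = z≤n
sumF≤n*maxF {suc n} g = +-mono-≤ (m≤m⊔n _ _)
  (≤-trans (sumF≤n*maxF (λ i → g (fsuc i))) (*-monoʳ-≤ n (m≤n⊔m (g fzero) _)))

<ᵇ≡false⇒≥ : ∀ {b x} → (b <ᵇ x) ≡ false → x ≤ b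
<ᵇ≡false⇒≥ {b} {x} b≮x with b <ᵇ x | <ᵇ-reflects-< b x
... | false | ofⁿ b≮x = ≮⇒≥ b≮x

foldl-increase≤ : ∀ {S X : Set} (μ : S → ℕ) (f : S → X → S) {d} →
                  (∀ s x → μ (f s x) ≤ μ s + d) →
                  ∀ s xs → μ (foldl f s xs) ≤ μ s + length xs * d
foldl-increase≤ μ f step≤ s []       = m≤m+n _ _
foldl-increase≤ μ f {d} step≤ s (x ∷ xs) = begin
  μ (foldl f (f s x) xs)         ≤⟨ foldl-increase≤ μ f step≤ (f s x) xs ⟩
  μ (f s x) + length xs * d      ≤⟨ +-monoˡ-≤ _ (step≤ s x) ⟩
  μ s + d + length xs * d        ≡⟨ +-assoc (μ s) d _ ⟩
  μ s + (d + length xs * d)      ∎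
  where open ≤-Reasoning

foldl-invariant : ∀ {S X : Set} (f : S → X → S) (Inv : (X → Set) → S → Set) →
                  (∀ {D D′ s} → (∀ x → D′ x → D x) → Inv D s → Inv D′ s) →
                  (∀ {D} s x → Inv D s → Inv (λ y → D y ⊎ y ≡ x) (f s x)) →
                  ∀ {D} s xs → Inv D s → Inv (λ y → D y ⊎ y ∈ xs) (foldl f s xs)
foldl-invariant f Inv weaken step {D} s []       inv = weaken done⊆ inv
  where
  done⊆ : ∀ y → D y ⊎ y ∈ [] → D y
  done⊆ y (inj₁ d) = d
foldl-invariant f Inv weaken step {D} s (x ∷ xs) inv =
  weaken done⊆ (foldl-invariant f Inv weaken step (f s x) xs (step s x inv))
  where
  done⊆ : ∀ y → D y ⊎ y ∈ x ∷ xs → (D y ⊎ y ≡ x) ⊎ y ∈ xs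
  done⊆ y (inj₁ d)            = inj₁ (inj₁ d)
  done⊆ y (inj₂ (here y≡x))   = inj₁ (inj₂ y≡x)
  done⊆ y (inj₂ (there y∈xs)) = inj₂ y∈xs

c+s+s+s≤c+3k : ∀ c {s k} → s ≤ k → c + s + s + s ≤ c + 3 * k
c+s+s+s≤c+3k c {s} s≤k = ≤-trans (≤-reflexive (regroup c s)) (+-monoʳ-≤ c (*-monoʳ-≤ 3 s≤k))
  where
  regroup : ∀ c s → c + s + s + s ≡ c + 3 * s
  regroup = solve-∀

length-reverse-allFin : ∀ m → length (reverse (allFin m)) ≡ m
length-reverse-allFin m = trans (length-reverse (allFin m)) (length-tabulate id)

_without_ : ∀ {m} → Subset m → Fin m → Subset m
(R without j) j′ = R j′ ∧ not ⌊ j′ ≟ j ⌋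

without-removes : ∀ {m} (R : Subset m) j → (R without j) j ≡ false
without-removes R j with j ≟ j
... | yes _  = ∧-zeroʳ (R j)
... | no j≢j with () ← j≢j refl

module _ {n m : ℕ} (A : Matrix n m) (b : ℕ) where

  surviving : Subset m → State A
  surviving R i j = A i j ∧ R j

  removePaper-surviving : ∀ R j i j′ → removePaper A (surviving R) j i j′ ≡ surviving (R without j) i j′
  removePaper-surviving R j i j′ with j′ ≟ j
  ... | no _ rewrite ∧-zeroʳ (A i j) = ∧-assoc (A i j′) (R j′) true
  ... | yes refl with A i j
  ...   | true  = refl
  ...   | false = refl

  removePaper-⊆ : ∀ P j i j′ → removePaper A P j i j′ ≡ true → P i j′ ≡ true
  removePaper-⊆ P j i j′ = ∧-conicalˡ (P i j′) _

  record Invariant (Done : Fin m → Set) (P : State A) : Set where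
    field
      survivors : Subset m
      shape     : ∀ i j → P i j ≡ surviving survivors i j
      bounded   : ∀ i j → Done j → P i j ≡ true → card (P i) ≤ b

    author-of-kept : ∀ {i j} → P i j ≡ true → A i j ≡ true
    author-of-kept {i} {j} pij = ∧-conicalˡ _ _ (trans (sym (shape i j)) pij)

    kept-by-all-authors : ∀ {i i′ j} → A i j ≡ true → P i′ j ≡ true → P i j ≡ true
    kept-by-all-authors {i} {i′} {j} aij pi′j = begin
      P i j                  ≡⟨ shape i j ⟩
      A i j ∧ survivors j    ≡⟨ cong (_∧ survivors j) aij ⟩
      survivors j            ≡⟨ ∧-conicalʳ _ _ (trans (sym (shape i′ j)) pi′j) ⟩
      true                   ∎
      where open ≡-Reasoning

  open Invariant

  initial-invariant : Invariant (λ _ → ⊥) (initState A)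
  initial-invariant = record
    { survivors = λ _ → true
    ; shape     = λ i j → sym (∧-identityʳ (A i j))
    ; bounded   = λ _ _ ()
    }

  weaken-invariant : ∀ {D D′ P} → (∀ j → D′ j → D j) → Invariant D P → Invariant D′ P
  weaken-invariant D′⊆D I = record
    { survivors = survivors I
    ; shape     = shape I
    ; bounded   = λ i j d → bounded I i j (D′⊆D j d)
    }

  reject-preserves : ∀ {D P} j → Invariant D P → Invariant (λ y → D y ⊎ y ≡ j) (removePaper A P j)
  reject-preserves {D} {P} j I = record
    { survivors = survivors I without j
    ; shape     = shape′
    ; bounded   = bounded′
    }
    where
    shape′ : ∀ i j′ → removePaper A P j i j′ ≡ surviving (survivors I without j) i j′
    shape′ i j′ = trans (cong (_∧ not (A i j ∧ ⌊ j′ ≟ j ⌋)) (shape I i j′))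
                        (removePaper-surviving (survivors I) j i j′)

    j-removed : ∀ i → removePaper A P j i j ≡ false
    j-removed i = begin
      removePaper A P j i j                  ≡⟨ shape′ i j ⟩
      A i j ∧ (survivors I without j) j      ≡⟨ cong (A i j ∧_) (without-removes (survivors I) j) ⟩
      A i j ∧ false                          ≡⟨ ∧-zeroʳ (A i j) ⟩
      false                                  ∎
      where open ≡-Reasoning

    bounded′ : ∀ i j′ → D j′ ⊎ j′ ≡ j → removePaper A P j i j′ ≡ true → card (removePaper A P j i) ≤ b
    bounded′ i j′ (inj₁ d) p′ij′ =
      ≤-trans (card-mono (removePaper-⊆ P j i)) (bounded I i j′ d (removePaper-⊆ P j i j′ p′ij′))
    bounded′ i j′ (inj₂ refl) p′ij with () ← trans (sym p′ij) (j-removed i)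

  keep-preserves : ∀ {D P} j → rejectCond A b P j ≡ false → Invariant D P →
                   Invariant (λ y → D y ⊎ y ≡ j) P
  keep-preserves {D} {P} j noReject I = record
    { survivors = survivors I
    ; shape     = shape I
    ; bounded   = bounded′
    }
    where
    bounded′ : ∀ i j′ → D j′ ⊎ j′ ≡ j → P i j′ ≡ true → card (P i) ≤ b
    bounded′ i j′ (inj₁ d)    pij′ = bounded I i j′ d pij′
    bounded′ i j′ (inj₂ refl) pij  = <ᵇ≡false⇒≥ (begin
      b <ᵇ card (P i)              ≡⟨ cong (_∧ (b <ᵇ card (P i))) (author-of-kept I pij) ⟨
      A i j ∧ (b <ᵇ card (P i))    ≡⟨ anyF-false⇒∀ _ noReject i ⟩
      false                        ∎)
      where open ≡-Reasoning

  step-preserves : ∀ {D} s j → Invariant D (proj₁ s) → Invariant (λ y → D y ⊎ y ≡ j) (proj₁ (step A b s j))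
  step-preserves (P , c) j I with rejectCond A b P j in cond
  ... | true  = reject-preserves j I
  ... | false = keep-preserves j cond I

  loop-invariant : Invariant (λ j → ⊥ ⊎ j ∈ reverse (allFin m)) (proj₁ (loop A b))
  loop-invariant = foldl-invariant (step A b) (λ D s → Invariant D (proj₁ s)) weaken-invariant step-preserves
                     (initState A , initCost A) (reverse (allFin m)) initial-invariant

  backwardReject-feasible : Feasible A b (backwardReject A b)
  backwardReject-feasible i = begin
    card (λ j → A i j ∧ backwardReject A b j)  ≤⟨ card-mono selected⇒kept ⟩
    card (P i)                                 ≤⟨ card≤-byMember (P i) (λ j → bounded loop-invariant i j (inj₂ (examined j))) ⟩
    b                                          ∎
    where
    open ≤-Reasoning
    P : State A
    P = proj₁ (loop A b)

    examined : ∀ j → j ∈ reverse (allFin m)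
    examined j = reverse⁺ (∈-allFin j)

    selected⇒kept : ∀ j → (A i j ∧ backwardReject A b j) ≡ true → P i j ≡ true
    selected⇒kept j aij∧xj with i′ , pi′j ← anyF-true⇒∃ (λ i′ → P i′ j) (∧-conicalʳ _ _ aij∧xj) =
      kept-by-all-authors loop-invariant (∧-conicalˡ _ _ aij∧xj) pi′j

  |authors|≤k₂ : ∀ j → card (authorsOf A j) ≤ k₂ A
  |authors|≤k₂ = maxF-upperBound (λ j → card (authorsOf A j))

  step-cost : ∀ s j → proj₂ (step A b s j) ≤ proj₂ s + 3 * k₂ A
  step-cost (P , c) j with rejectCond A b P j
  ... | true  = c+s+s+s≤c+3k c (|authors|≤k₂ j)
  ... | false = ≤-trans (m≤m+n _ _) (c+s+s+s≤c+3k c (|authors|≤k₂ j))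

  backwardReject-cost : backwardRejectCost A b ≤ 3 * (n * k₁ A + m * k₂ A)
  backwardReject-cost = begin
    proj₂ (loop A b) + initCost A
      ≤⟨ +-monoˡ-≤ _ (foldl-increase≤ proj₂ (step A b) step-cost (initState A , initCost A) papers) ⟩
    initCost A + length papers * (3 * k₂ A) + initCost A
      ≡⟨ cong (λ l → initCost A + l * (3 * k₂ A) + initCost A) (length-reverse-allFin m) ⟩
    initCost A + m * (3 * k₂ A) + initCost A
      ≤⟨ +-mono-≤ (+-monoˡ-≤ _ initCost≤) initCost≤ ⟩
    n * k₁ A + m * (3 * k₂ A) + n * k₁ A
      ≤⟨ m≤m+n _ (n * k₁ A) ⟩
    n * k₁ A + m * (3 * k₂ A) + n * k₁ A + n * k₁ A
      ≡⟨ regroup (n * k₁ A) m (k₂ A) ⟩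
    3 * (n * k₁ A + m * k₂ A)
      ∎
    where
    open ≤-Reasoning
    papers : List (Fin m)
    papers = reverse (allFin m)

    initCost≤ : initCost A ≤ n * k₁ A
    initCost≤ = sumF≤n*maxF (λ i → card (papersOf A i))

    regroup : ∀ x m k → x + m * (3 * k) + x + x ≡ 3 * (x + m * k)
    regroup = solve-∀

mainTheorem3 : Σ ℕ (λ c → (n m b : ℕ) → .{{_ : NonZero n}} → .{{_ : NonZero m}} → .{{_ : NonZero b}} → (A : Matrix n m) →
    (backwardRejectCost A b ≤ c * (n * k₁ A + m * k₂ A)) × Feasible A b (backwardReject A b))
mainTheorem3 = 3 , λ n m b A → backwardReject-cost A b , backwardReject-feasible A b
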